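{- Let $q=p^k$ be a power of a prime $p$ and let $L\subseteq[q-1]$. Let $\mathcal{F}\subseteq 2^{[n]}$ be a $q$-modular $L$-differencing Sperner system. If $\sum_{\ell\in L}v_p(\ell)<k$, then $$|\mathcal{F}|\le\sum_{i=0}^{|L|}\binom{n}{i}.$$
   Context: $n$ is a positive integer, $[n]=\{1,\ldots,n\}$, $[q-1]=\{1,\ldots,q-1\}$, $2^{[n]}$ is the family of all subsets of $[n]$. For an integer $m$, $v_p(m)$ is the largest non-negative integer $t$ with $p^t\mid m$. A family $\mathcal{F}\subseteq 2^{[n]}$ is $q$-modular $L$-differencing Sperner if for any distinct $A,B\in\mathcal{F}$ there is $\ell\in L$ with $|A\setminus B|\equiv\ell\pmod q$. -}

module Defs where

open import Data.Nat using (ℕ; zero; suc; _+_; _^_; _∸_; _≤_; _<_; _%_; _/_; NonZero)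
open import Data.Nat.Divisibility using (_∣_; _∣?_)
open import Data.Nat.Combinatorics using (_C_)
open import Data.Fin.Subset using (Subset; _─_; ∣_∣)
open import Data.List using (List; map; upTo; length)
open import Data.Nat.ListAction using (sum)
open import Data.List.Membership.Propositional using (_∈_)
open import Data.List.Relation.Unary.Unique.Propositional using (Unique)
open import Data.List.Relation.Unary.All using (All)
open import Relation.Binary.PropositionalEquality using (_≡_; _≢_)
open import Relation.Nullary using (yes; no)
open import Data.Product using (∃-syntax; _×_)

-- Called with fuel m, which suffices whenever p ≥ 2 and m ≥ 1,
-- since p^t ∣ m with m ≥ 1 forces t < m.
vp-fuel : ℕ → (p : ℕ) → .{{NonZero p}} → ℕ → ℕ
vp-fuel zero    p m = 0
vp-fuel (suc f) p m with p ∣? m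
... | yes _ = suc (vp-fuel f p (m / p))
... | no  _ = 0

v : (p : ℕ) → .{{NonZero p}} → ℕ → ℕ
v p m = vp-fuel m p m

sumV : (p : ℕ) → .{{NonZero p}} → List ℕ → ℕ
sumV p L = sum (map (v p) L)

_≡_[mod_] : ℕ → ℕ → (q : ℕ) → .{{NonZero q}} → Set
a ≡ b [mod q ] = a % q ≡ b % q

DifferencingSperner : ∀ {n} (q : ℕ) → .{{NonZero q}} → List ℕ → List (Subset n) → Set
DifferencingSperner q L F =
  ∀ {A B} → A ∈ F → B ∈ F → A ≢ B → ∃[ ℓ ] (ℓ ∈ L × ∣ A ─ B ∣ ≡ ℓ [mod q ])

binomSum : ℕ → ℕ → ℕ
binomSum n m = sum (map (n C_) (upTo (suc m)))

{-# OPTIONS --safe #-}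
module Submission where

-- For A ∈ F let f_A(X) = ∏_{ℓ ∈ L} (|A ∖ X| − ℓ). As a function of the indicator
-- vector of X it is a multilinear integer polynomial of degree at most |L|, so if
-- |F| exceeded the number ∑_{i ≤ |L|} C(n,i) of monomials of degree at most |L|,
-- elimination over ℤ would give weights w_A, not all zero, with ∑_A w_A f_A = 0.
-- Evaluate this relation at X = B ∈ F. For A ≠ B some factor of f_A(B) is divisible
-- by q = p^k, whereas |f_B(B)| = ∏ ℓ has p-adic valuation ∑ v_p(ℓ) < k. Hence if p^j
-- divides every w_A then so does p^(j+1); all weights are divisible by every power
-- of p, so they all vanish, a contradiction.

open import Defs

open import Data.Nat as ℕ using (ℕ; zero; suc; 2+; _≤_; _<_; _∸_; z≤n; s≤s; _^_; NonZero)
import Data.Nat.Properties as ℕ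
open import Data.Integer as ℤ using (ℤ; +_; 0ℤ; 1ℤ; -1ℤ; _+_; _*_; -_; _-_)
import Data.Integer.Properties as ℤ
open import Data.Integer.Divisibility.Signed as ℤ∣ using (divides)
open import Data.Integer.Tactic.RingSolver using (solve-∀)
import Algebra.Properties.CommutativeSemigroup ℤ.+-commutativeSemigroup as +-CS
import Algebra.Properties.CommutativeSemigroup ℤ.*-commutativeSemigroup as *-CS
import Algebra.Properties.CommutativeSemigroup ℕ.+-commutativeSemigroup as ℕ-+
import Algebra.Properties.CommutativeSemigroup ℕ.*-commutativeSemigroup as ℕ-*
import Data.Nat.Tactic.RingSolver as ℕ
open import Data.Nat.Divisibility
  using (_∣_; _∣?_; divides; ∣-trans; m∣m*n; 1∣_; ∣1⇒≡1; ∣⇒≤; m*n∣⇒m∣; *-monoˡ-∣; *-cancelˡ-∣)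
open import Data.Nat.DivMod using (_/_; _%_; m≡m%n+[m/n]*n; m/n<m; m≥n⇒m/n>0; m*[n/m]≡n)
open import Data.Nat.Primality using (Prime; prime⇒nonTrivial; euclidsLemma)
open import Data.List using (List; []; _∷_; _++_; map; concatMap; length; upTo)
open import Data.Nat.ListAction using (sum; product)
import Data.Nat.ListAction.Properties as ℕ
open import Data.Nat.Combinatorics using (_C_)
import Data.Nat.Combinatorics as ℕ
open import Data.List.Relation.Unary.All as All using (All; []; _∷_)
import Data.List.Relation.Unary.All.Properties as All
open import Data.List.Relation.Unary.Any as Any using (Any; here; there)
open import Data.List.Relation.Unary.Unique.Propositional using (Unique)
open import Data.List.Relation.Unary.AllPairs using ([]; _∷_)
open import Data.List.Membership.Propositional using (_∈_; find; lose)
import Data.List.Properties as List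
open import Data.Product using (Σ; _×_; _,_; proj₁; proj₂; map₂)
open import Data.Empty using (⊥-elim)
open import Data.Sum using (inj₁; inj₂; [_,_]′)
open import Function using (_∘_)
open import Data.Vec using ([]; _∷_)
import Data.Vec.Properties as Vec
import Data.Bool.Properties as Bool
open import Data.Fin.Subset using (Subset; outside; inside; ⊥; _∪_; _─_; ∣_∣)
open import Data.Fin.Subset.Properties using (∣⊥∣≡0)
open import Relation.Binary.Definitions using (DecidableEquality)
open import Relation.Binary.PropositionalEquality
open import Relation.Nullary using (yes; no; ¬_)

module _ {A : Set} where

  ∑ : List A → (A → ℤ) → ℤ
  ∑ []       f = 0ℤ
  ∑ (x ∷ xs) f = f x + ∑ xs f

  syntax ∑ xs (λ x → e) = ∑[ x ∈ xs ] e

  ∑-cong : ∀ xs {f g : A → ℤ} → (∀ x → f x ≡ g x) → ∑ xs f ≡ ∑ xs g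
  ∑-cong []       f≗g = refl
  ∑-cong (x ∷ xs) f≗g = cong₂ _+_ (f≗g x) (∑-cong xs f≗g)

  ∑-cong-All : ∀ {xs} {f g : A → ℤ} → All (λ x → f x ≡ g x) xs → ∑ xs f ≡ ∑ xs g
  ∑-cong-All []       = refl
  ∑-cong-All (e ∷ es) = cong₂ _+_ e (∑-cong-All es)

  ∑-zero : ∀ xs → ∑[ x ∈ xs ] 0ℤ ≡ 0ℤ
  ∑-zero []       = refl
  ∑-zero (x ∷ xs) = trans (ℤ.+-identityˡ _) (∑-zero xs)

  ∑-zero-All : ∀ {xs} {f : A → ℤ} → All (λ x → f x ≡ 0ℤ) xs → ∑ xs f ≡ 0ℤ
  ∑-zero-All {xs} fs≡0 = trans (∑-cong-All fs≡0) (∑-zero xs)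

  ∑-+ : ∀ xs (f g : A → ℤ) → ∑[ x ∈ xs ] (f x + g x) ≡ ∑ xs f + ∑ xs g
  ∑-+ []       f g = refl
  ∑-+ (x ∷ xs) f g = trans (cong (_+_ (f x + g x)) (∑-+ xs f g)) (+-CS.interchange (f x) (g x) _ _)

  ∑-*ˡ : ∀ xs c (f : A → ℤ) → ∑[ x ∈ xs ] (c * f x) ≡ c * ∑ xs f
  ∑-*ˡ []       c f = sym (ℤ.*-zeroʳ c)
  ∑-*ˡ (x ∷ xs) c f = trans (cong (_+_ (c * f x)) (∑-*ˡ xs c f)) (sym (ℤ.*-distribˡ-+ c (f x) _))

  ∑-*ʳ : ∀ xs c (f : A → ℤ) → ∑[ x ∈ xs ] (f x * c) ≡ ∑ xs f * c
  ∑-*ʳ xs c f = begin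
    ∑[ x ∈ xs ] (f x * c) ≡⟨ ∑-cong xs (λ x → ℤ.*-comm (f x) c) ⟩
    ∑[ x ∈ xs ] (c * f x) ≡⟨ ∑-*ˡ xs c f ⟩
    c * ∑ xs f            ≡⟨ ℤ.*-comm c _ ⟩
    ∑ xs f * c            ∎
    where open ≡-Reasoning

  ∑-++ : ∀ xs ys (f : A → ℤ) → ∑ (xs ++ ys) f ≡ ∑ xs f + ∑ ys f
  ∑-++ []       ys f = sym (ℤ.+-identityˡ _)
  ∑-++ (x ∷ xs) ys f = trans (cong (_+_ (f x)) (∑-++ xs ys f)) (sym (ℤ.+-assoc (f x) _ _))

  ∑-∣ : ∀ {d} xs {f : A → ℤ} → All (λ x → d ℤ∣.∣ f x) xs → d ℤ∣.∣ ∑ xs f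
  ∑-∣ []       []         = divides 0ℤ refl
  ∑-∣ (x ∷ xs) (d∣ ∷ d∣s) = ℤ∣.∣m∣n⇒∣m+n d∣ (∑-∣ xs d∣s)

  ∑-─ : ∀ {x xs} (x∈xs : x ∈ xs) (f : A → ℤ) → ∑ xs f ≡ f x + ∑ (xs Any.─ x∈xs) f
  ∑-─ (here refl)                   f = refl
  ∑-─ {x} {y ∷ xs} (there x∈xs) f = begin
    f y + ∑ xs f                       ≡⟨ cong (_+_ (f y)) (∑-─ x∈xs f) ⟩
    f y + (f x + ∑ (xs Any.─ x∈xs) f)  ≡⟨ +-CS.x∙yz≈y∙xz (f y) (f x) _ ⟩
    f x + (f y + ∑ (xs Any.─ x∈xs) f)  ∎
    where open ≡-Reasoning

module _ {A B : Set} where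

  ∑-map : ∀ (g : A → B) xs (f : B → ℤ) → ∑ (map g xs) f ≡ ∑ xs (f ∘ g)
  ∑-map g []       f = refl
  ∑-map g (x ∷ xs) f = cong (_+_ (f (g x))) (∑-map g xs f)

  ∑-concatMap : ∀ (g : A → List B) xs (f : B → ℤ) → ∑ (concatMap g xs) f ≡ ∑[ x ∈ xs ] ∑ (g x) f
  ∑-concatMap g []       f = refl
  ∑-concatMap g (x ∷ xs) f = trans (∑-++ (g x) _ f) (cong (_+_ (∑ (g x) f)) (∑-concatMap g xs f))

  ∑-comm : ∀ xs ys (f : A → B → ℤ) → ∑[ x ∈ xs ] ∑[ y ∈ ys ] f x y ≡ ∑[ y ∈ ys ] ∑[ x ∈ xs ] f x y
  ∑-comm []       ys f = sym (∑-zero ys)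
  ∑-comm (x ∷ xs) ys f = trans (cong (_+_ (∑ ys (f x))) (∑-comm xs ys f)) (sym (∑-+ ys (f x) _))

module _ {A : Set} where

  ∈-─⁻ : ∀ {x y} {xs : List A} (x∈xs : x ∈ xs) → y ∈ (xs Any.─ x∈xs) → y ∈ xs
  ∈-─⁻ (here _)     y∈        = there y∈
  ∈-─⁻ (there x∈xs) (here y≡)  = here y≡
  ∈-─⁻ (there x∈xs) (there y∈) = there (∈-─⁻ x∈xs y∈)

  Unique-─ : ∀ {x} {xs : List A} (x∈xs : x ∈ xs) → Unique xs → Unique (xs Any.─ x∈xs)
  Unique-─ (here _)     (_  ∷ u) = u
  Unique-─ (there x∈xs) (y∉ ∷ u) = All.─⁺ x∈xs y∉ ∷ Unique-─ x∈xs u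

  Unique⇒All≢─ : ∀ {x} {xs : List A} (x∈xs : x ∈ xs) → Unique xs → All (_≢ x) (xs Any.─ x∈xs)
  Unique⇒All≢─ (here refl)  (x∉ ∷ _) = All.map (λ x≢y y≡x → x≢y (sym y≡x)) x∉
  Unique⇒All≢─ (there x∈xs) (y∉ ∷ u) = All.lookup y∉ x∈xs ∷ Unique⇒All≢─ x∈xs u

record LinearDependency {X Y : Set} (F : List X) (K : List Y) (c : X → Y → ℤ) : Set where
  field
    coeff      : X → ℤ
    nontrivial : Any (λ A → coeff A ≢ 0ℤ) F
    vanishes   : All (λ T → ∑[ A ∈ F ] (coeff A * c A T) ≡ 0ℤ) K

module _ {X Y : Set} (_≟_ : DecidableEquality X) where

  -- Pivot on P with c P T ≢ 0: a dependency μ of the vectors c P T · c A − c A T · c P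
  -- (A ≠ P), whose T-coordinate is 0, lifts to the original vectors by giving P the
  -- weight −∑_B μ_B · c B T.
  private
    module Elimination (F : List X) (F-unique : Unique F) (c : X → Y → ℤ) (T : Y)
                       {P : X} (P∈F : P ∈ F) where

      F′ : List X
      F′ = F Any.─ P∈F

      eliminated : X → Y → ℤ
      eliminated A U = c P T * c A U - c A T * c P U

      module Lift (μ : X → ℤ) where

        S : Y → ℤ
        S U = ∑[ B ∈ F′ ] (μ B * c B U)

        coeff : X → ℤ
        coeff A with A ≟ P
        ... | yes _ = - S T
        ... | no  _ = c P T * μ A

        coeff-pivot : coeff P ≡ - S T
        coeff-pivot with P ≟ P
        ... | yes _   = refl
        ... | no  P≢P = ⊥-elim (P≢P refl)

        coeff-other : ∀ {A} → A ≢ P → coeff A ≡ c P T * μ A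
        coeff-other {A} A≢P with A ≟ P
        ... | yes A≡P = ⊥-elim (A≢P A≡P)
        ... | no  _   = refl

        combination : ∀ U → ∑[ A ∈ F ] (coeff A * c A U) ≡ - S T * c P U + c P T * S U
        combination U = begin
          ∑[ A ∈ F ] (coeff A * c A U)                    ≡⟨ ∑-─ P∈F _ ⟩
          coeff P * c P U + ∑[ A ∈ F′ ] (coeff A * c A U) ≡⟨ cong₂ _+_ (cong (_* c P U) coeff-pivot) rest ⟩
          - S T * c P U + c P T * S U                     ∎
          where
          open ≡-Reasoning
          rest : ∑[ A ∈ F′ ] (coeff A * c A U) ≡ c P T * S U
          rest = trans (∑-cong-All (All.map (λ {A} A≢P → trans (cong (_* c A U) (coeff-other A≢P))
                                                               (ℤ.*-assoc (c P T) (μ A) (c A U)))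
                                            (Unique⇒All≢─ P∈F F-unique)))
                       (∑-*ˡ F′ (c P T) _)

        vanishes-at-pivot : ∑[ A ∈ F ] (coeff A * c A T) ≡ 0ℤ
        vanishes-at-pivot = trans (combination T) (cancel (S T) (c P T))
          where cancel : ∀ s a → - s * a + a * s ≡ 0ℤ
                cancel = solve-∀

        vanishes-elsewhere : ∀ U → ∑[ A ∈ F′ ] (μ A * eliminated A U) ≡ 0ℤ → ∑[ A ∈ F ] (coeff A * c A U) ≡ 0ℤ
        vanishes-elsewhere U μ-vanishes = begin
          ∑[ A ∈ F ] (coeff A * c A U)
            ≡⟨ combination U ⟩
          - S T * c P U + c P T * S U
            ≡⟨ expand ⟨
          ∑[ A ∈ F′ ] (c P T * (μ A * c A U) + - c P U * (μ A * c A T))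
            ≡⟨ ∑-cong F′ (λ A → distribute (μ A) (c P T) (c A U) (c A T) (c P U)) ⟨
          ∑[ A ∈ F′ ] (μ A * eliminated A U)
            ≡⟨ μ-vanishes ⟩
          0ℤ ∎
          where
          open ≡-Reasoning
          distribute : ∀ m a x y z → m * (a * x - y * z) ≡ a * (m * x) + - z * (m * y)
          distribute = solve-∀
          reorder : ∀ s t a z → a * s + - z * t ≡ - t * z + a * s
          reorder = solve-∀
          expand : ∑[ A ∈ F′ ] (c P T * (μ A * c A U) + - c P U * (μ A * c A T)) ≡ - S T * c P U + c P T * S U
          expand = trans (∑-+ F′ _ _) (trans (cong₂ _+_ (∑-*ˡ F′ (c P T) _) (∑-*ˡ F′ (- c P U) _))
                                             (reorder (S U) (S T) (c P T) (c P U)))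

        nontrivial : c P T ≢ 0ℤ → Any (λ A → μ A ≢ 0ℤ) F′ → Any (λ A → coeff A ≢ 0ℤ) F
        nontrivial cPT≢0 μ≢0 with find μ≢0
        ... | A , A∈F′ , μA≢0 = lose (∈-─⁻ P∈F A∈F′) λ coeffA≡0 →
          [ cPT≢0 , μA≢0 ]′ (ℤ.i*j≡0⇒i≡0∨j≡0 (c P T)
            (trans (sym (coeff-other (All.lookup (Unique⇒All≢─ P∈F F-unique) A∈F′))) coeffA≡0))

  linearDependency : ∀ F K → Unique F → length K < length F → (c : X → Y → ℤ) → LinearDependency F K c
  linearDependency (A ∷ F) [] _ _ c = record { coeff = λ _ → 1ℤ ; nontrivial = here (λ ()) ; vanishes = [] }
  linearDependency F (T ∷ K) F-unique K<F c with All.all? (λ A → c A T ℤ.≟ 0ℤ) F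
  ... | yes column≡0 = record
    { coeff      = coeff
    ; nontrivial = nontrivial
    ; vanishes   = ∑-zero-All (All.map (λ {A} cAT≡0 → trans (cong (coeff A *_) cAT≡0) (ℤ.*-zeroʳ (coeff A))) column≡0)
                 ∷ vanishes }
    where open LinearDependency (linearDependency F K F-unique (ℕ.<-trans (ℕ.n<1+n _) K<F) c)
  ... | no column≢0 with find (All.¬All⇒Any¬ (λ A → c A T ℤ.≟ 0ℤ) F column≢0)
  ...   | P , P∈F , cPT≢0 = record
    { coeff      = coeff
    ; nontrivial = nontrivial cPT≢0 μ.nontrivial
    ; vanishes   = vanishes-at-pivot ∷ All.map (λ {U} → vanishes-elsewhere U) μ.vanishes }
    where
    open Elimination F F-unique c T P∈F
    F′-longer : length K < length F′
    F′-longer = ℕ.≤-pred (subst (suc (suc (length K)) ≤_) (List.length-removeAt′ F (Any.index P∈F)) K<F)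
    module μ = LinearDependency (linearDependency F′ K (Unique-─ P∈F F-unique) F′-longer eliminated)
    open Lift μ.coeff

-- A term (a , S) is a · ∏_{i ∈ S} xᵢ; at the indicator vector of X the monomial
-- ∏_{i ∈ S} xᵢ takes the value [S ⊆ X], which is what monomial S X computes.
Term : ℕ → Set
Term n = ℤ × Subset n

Poly : ℕ → Set
Poly n = List (Term n)

monomial : ∀ {n} → Subset n → Subset n → ℤ
monomial []            []            = 1ℤ
monomial (outside ∷ S) (_       ∷ X) = monomial S X
monomial (inside  ∷ S) (inside  ∷ X) = monomial S X
monomial (inside  ∷ S) (outside ∷ X) = 0ℤ

evalTerm : ∀ {n} → Term n → Subset n → ℤ
evalTerm (a , S) X = a * monomial S X

⟦_⟧ : ∀ {n} → Poly n → Subset n → ℤ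
⟦ P ⟧ X = ∑[ t ∈ P ] evalTerm t X

_*ᴾ_ : ∀ {n} → Poly n → Poly n → Poly n
P *ᴾ Q = concatMap (λ (a , S) → map (λ (b , T) → a * b , S ∪ T) Q) P

DegreeAtMost : ∀ {n} → ℕ → Poly n → Set
DegreeAtMost s P = All (λ t → ∣ proj₂ t ∣ ≤ s) P

monomial-⊥ : ∀ {n} (X : Subset n) → monomial ⊥ X ≡ 1ℤ
monomial-⊥ []      = refl
monomial-⊥ (_ ∷ X) = monomial-⊥ X

monomial-∪ : ∀ {n} (S T X : Subset n) → monomial (S ∪ T) X ≡ monomial S X * monomial T X
monomial-∪ []            []            []            = refl
monomial-∪ (outside ∷ S) (outside ∷ T) (_       ∷ X) = monomial-∪ S T X
monomial-∪ (outside ∷ S) (inside  ∷ T) (inside  ∷ X) = monomial-∪ S T X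
monomial-∪ (inside  ∷ S) (outside ∷ T) (inside  ∷ X) = monomial-∪ S T X
monomial-∪ (inside  ∷ S) (inside  ∷ T) (inside  ∷ X) = monomial-∪ S T X
monomial-∪ (outside ∷ S) (inside  ∷ T) (outside ∷ X) = sym (ℤ.*-zeroʳ (monomial S X))
monomial-∪ (inside  ∷ S) (_       ∷ T) (outside ∷ X) = refl

evalTerm-* : ∀ {n} a b (S T X : Subset n) → evalTerm (a * b , S ∪ T) X ≡ evalTerm (a , S) X * evalTerm (b , T) X
evalTerm-* a b S T X = trans (cong (a * b *_) (monomial-∪ S T X)) (*-CS.interchange a b _ _)

⟦*ᴾ⟧ : ∀ {n} (P Q : Poly n) X → ⟦ P *ᴾ Q ⟧ X ≡ ⟦ P ⟧ X * ⟦ Q ⟧ X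
⟦*ᴾ⟧ P Q X = begin
  ⟦ P *ᴾ Q ⟧ X
    ≡⟨ trans (∑-concatMap _ P _) (∑-cong P (λ _ → ∑-map _ Q _)) ⟩
  ∑[ (a , S) ∈ P ] ∑[ (b , T) ∈ Q ] evalTerm (a * b , S ∪ T) X
    ≡⟨ ∑-cong P (λ (a , S) → ∑-cong Q (λ (b , T) → evalTerm-* a b S T X)) ⟩
  ∑[ s ∈ P ] ∑[ t ∈ Q ] (evalTerm s X * evalTerm t X)
    ≡⟨ ∑-cong P (λ s → ∑-*ˡ Q (evalTerm s X) _) ⟩
  ∑[ s ∈ P ] (evalTerm s X * ⟦ Q ⟧ X)
    ≡⟨ ∑-*ʳ P _ _ ⟩
  ⟦ P ⟧ X * ⟦ Q ⟧ X ∎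
  where open ≡-Reasoning

∣p∪q∣≤∣p∣+∣q∣ : ∀ {n} (p q : Subset n) → ∣ p ∪ q ∣ ≤ ∣ p ∣ ℕ.+ ∣ q ∣
∣p∪q∣≤∣p∣+∣q∣ []            []            = z≤n
∣p∪q∣≤∣p∣+∣q∣ (outside ∷ p) (outside ∷ q) = ∣p∪q∣≤∣p∣+∣q∣ p q
∣p∪q∣≤∣p∣+∣q∣ (inside  ∷ p) (outside ∷ q) = s≤s (∣p∪q∣≤∣p∣+∣q∣ p q)
∣p∪q∣≤∣p∣+∣q∣ (outside ∷ p) (inside  ∷ q) =
  subst (suc ∣ p ∪ q ∣ ≤_) (sym (ℕ.+-suc ∣ p ∣ ∣ q ∣)) (s≤s (∣p∪q∣≤∣p∣+∣q∣ p q))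
∣p∪q∣≤∣p∣+∣q∣ (inside  ∷ p) (inside  ∷ q) =
  s≤s (ℕ.≤-trans (∣p∪q∣≤∣p∣+∣q∣ p q) (ℕ.+-monoʳ-≤ ∣ p ∣ (ℕ.n≤1+n ∣ q ∣)))

∣⊥∣≤ : ∀ {n} s → ∣ ⊥ {n = n} ∣ ≤ s
∣⊥∣≤ {n} s = subst (_≤ s) (sym (∣⊥∣≡0 n)) z≤n

degree-*ᴾ : ∀ {n s t} {P Q : Poly n} → DegreeAtMost s P → DegreeAtMost t Q → DegreeAtMost (s ℕ.+ t) (P *ᴾ Q)
degree-*ᴾ {P = P} {Q} P≤s Q≤t =
  All.concat⁺ (All.map⁺ (All.map (λ {(_ , S)} ∣S∣≤s → All.map⁺ (All.map (λ {(_ , T)} ∣T∣≤t →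
    ℕ.≤-trans (∣p∪q∣≤∣p∣+∣q∣ S T) (ℕ.+-mono-≤ ∣S∣≤s ∣T∣≤t)) Q≤t)) P≤s))

liftPoly : ∀ {n} → Poly n → Poly (suc n)
liftPoly = map (map₂ (outside ∷_))

⟦liftPoly⟧ : ∀ {n} (P : Poly n) x X → ⟦ liftPoly P ⟧ (x ∷ X) ≡ ⟦ P ⟧ X
⟦liftPoly⟧ P x X = ∑-map _ P _

degree-liftPoly : ∀ {n s} {P : Poly n} → DegreeAtMost s P → DegreeAtMost s (liftPoly P)
degree-liftPoly = All.map⁺

-- |A ∖ X| = ∑_{i ∈ A} (1 − xᵢ)
cardDiffPoly : ∀ {n} → Subset n → Poly n
cardDiffPoly []            = []
cardDiffPoly (outside ∷ A) = liftPoly (cardDiffPoly A)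
cardDiffPoly (inside  ∷ A) = (1ℤ , ⊥) ∷ (-1ℤ , inside ∷ ⊥) ∷ liftPoly (cardDiffPoly A)

⟦cardDiffPoly⟧ : ∀ {n} (A X : Subset n) → ⟦ cardDiffPoly A ⟧ X ≡ + ∣ A ─ X ∣
⟦cardDiffPoly⟧ []            []            = refl
⟦cardDiffPoly⟧ (outside ∷ A) (inside  ∷ X) = trans (⟦liftPoly⟧ (cardDiffPoly A) inside X) (⟦cardDiffPoly⟧ A X)
⟦cardDiffPoly⟧ (outside ∷ A) (outside ∷ X) = trans (⟦liftPoly⟧ (cardDiffPoly A) outside X) (⟦cardDiffPoly⟧ A X)
⟦cardDiffPoly⟧ (inside  ∷ A) (inside  ∷ X)
  rewrite monomial-⊥ X | ⟦liftPoly⟧ (cardDiffPoly A) inside X | ⟦cardDiffPoly⟧ A X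
  = trans (sym (ℤ.+-assoc 1ℤ -1ℤ (+ ∣ A ─ X ∣))) (ℤ.+-identityˡ (+ ∣ A ─ X ∣))
⟦cardDiffPoly⟧ (inside  ∷ A) (outside ∷ X)
  rewrite monomial-⊥ X | ⟦liftPoly⟧ (cardDiffPoly A) outside X | ⟦cardDiffPoly⟧ A X
  = refl

degree-cardDiffPoly : ∀ {n} (A : Subset n) → DegreeAtMost 1 (cardDiffPoly A)
degree-cardDiffPoly []            = []
degree-cardDiffPoly (outside ∷ A) = degree-liftPoly (degree-cardDiffPoly A)
degree-cardDiffPoly {suc n} (inside ∷ A) = ∣⊥∣≤ {suc n} 1 ∷ s≤s (∣⊥∣≤ {n} 0) ∷ degree-liftPoly (degree-cardDiffPoly A)

fPoly : ∀ {n} → Subset n → List ℕ → Poly n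
fPoly A []      = (1ℤ , ⊥) ∷ []
fPoly A (ℓ ∷ L) = ((- + ℓ , ⊥) ∷ cardDiffPoly A) *ᴾ fPoly A L

fValue : ∀ {n} → Subset n → Subset n → List ℕ → ℤ
fValue A X []      = 1ℤ
fValue A X (ℓ ∷ L) = (+ ∣ A ─ X ∣ - + ℓ) * fValue A X L

⟦fPoly⟧ : ∀ {n} (A X : Subset n) L → ⟦ fPoly A L ⟧ X ≡ fValue A X L
⟦fPoly⟧ A X [] rewrite monomial-⊥ X = refl
⟦fPoly⟧ A X (ℓ ∷ L) = trans (⟦*ᴾ⟧ ((- + ℓ , ⊥) ∷ cardDiffPoly A) (fPoly A L) X) (cong₂ _*_ linear (⟦fPoly⟧ A X L))
  where
  linear : - + ℓ * monomial ⊥ X + ⟦ cardDiffPoly A ⟧ X ≡ + ∣ A ─ X ∣ - + ℓ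
  linear rewrite monomial-⊥ X | ⟦cardDiffPoly⟧ A X =
    trans (cong (_+ + ∣ A ─ X ∣) (ℤ.*-identityʳ (- + ℓ))) (ℤ.+-comm (- + ℓ) (+ ∣ A ─ X ∣))

degree-fPoly : ∀ {n} (A : Subset n) L → DegreeAtMost (length L) (fPoly A L)
degree-fPoly {n} A []      = ∣⊥∣≤ {n} 0 ∷ []
degree-fPoly {n} A (ℓ ∷ L) =
  degree-*ᴾ {P = (- + ℓ , ⊥) ∷ cardDiffPoly A} (∣⊥∣≤ {n} 1 ∷ degree-cardDiffPoly A) (degree-fPoly A L)

smallSubsets : ∀ n → ℕ → List (Subset n)
smallSubsets zero    s       = [] ∷ []
smallSubsets (suc n) zero    = map (outside ∷_) (smallSubsets n zero)
smallSubsets (suc n) (suc s) = map (outside ∷_) (smallSubsets n (suc s)) ++ map (inside ∷_) (smallSubsets n s)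

δ : ∀ {n} → Subset n → Subset n → ℤ
δ []            []            = 1ℤ
δ (outside ∷ S) (outside ∷ T) = δ S T
δ (inside  ∷ S) (inside  ∷ T) = δ S T
δ (outside ∷ S) (inside  ∷ T) = 0ℤ
δ (inside  ∷ S) (outside ∷ T) = 0ℤ

∑-smallSubsets : ∀ n s (f : Subset (suc n) → ℤ) →
  ∑ (smallSubsets (suc n) (suc s)) f ≡ ∑ (smallSubsets n (suc s)) (f ∘ (outside ∷_)) + ∑ (smallSubsets n s) (f ∘ (inside ∷_))
∑-smallSubsets n s f = trans (∑-++ (map (outside ∷_) (smallSubsets n (suc s))) _ f)
                             (cong₂ _+_ (∑-map _ (smallSubsets n (suc s)) f) (∑-map _ (smallSubsets n s) f))

∑-δ : ∀ n s {S : Subset n} → ∣ S ∣ ≤ s → (h : Subset n → ℤ) → ∑[ T ∈ smallSubsets n s ] (δ S T * h T) ≡ h S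
∑-δ zero    s       {[]}          _           h = trans (ℤ.+-identityʳ _) (ℤ.*-identityˡ (h []))
∑-δ (suc n) zero    {outside ∷ S} ∣S∣≤0       h =
  trans (∑-map _ (smallSubsets n zero) _) (∑-δ n zero ∣S∣≤0 (h ∘ (outside ∷_)))
∑-δ (suc n) (suc s) {outside ∷ S} ∣S∣≤1+s     h = trans (∑-smallSubsets n s _)
  (trans (cong₂ _+_ (∑-δ n (suc s) ∣S∣≤1+s (h ∘ (outside ∷_))) (∑-zero (smallSubsets n s))) (ℤ.+-identityʳ _))
∑-δ (suc n) (suc s) {inside  ∷ S} (s≤s ∣S∣≤s) h = trans (∑-smallSubsets n s _)
  (trans (cong₂ _+_ (∑-zero (smallSubsets n (suc s))) (∑-δ n s ∣S∣≤s (h ∘ (inside ∷_)))) (ℤ.+-identityˡ _))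

coefficient : ∀ {n} → Poly n → Subset n → ℤ
coefficient P T = ∑[ (a , S) ∈ P ] (δ S T * a)

⟦⟧-coefficients : ∀ {n} s (P : Poly n) → DegreeAtMost s P → ∀ X →
  ∑[ T ∈ smallSubsets n s ] (coefficient P T * monomial T X) ≡ ⟦ P ⟧ X
⟦⟧-coefficients {n} s P P≤s X = begin
  ∑[ T ∈ K ] (coefficient P T * monomial T X)
    ≡⟨ ∑-cong K (λ T → ∑-*ʳ P (monomial T X) _) ⟨
  ∑[ T ∈ K ] ∑[ (a , S) ∈ P ] (δ S T * a * monomial T X)
    ≡⟨ ∑-cong K (λ T → ∑-cong P (λ (a , S) → ℤ.*-assoc (δ S T) a _)) ⟩
  ∑[ T ∈ K ] ∑[ (a , S) ∈ P ] (δ S T * (a * monomial T X))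
    ≡⟨ ∑-comm K P _ ⟩
  ∑[ (a , S) ∈ P ] ∑[ T ∈ K ] (δ S T * (a * monomial T X))
    ≡⟨ ∑-cong-All (All.map (λ {(a , S)} ∣S∣≤s → ∑-δ n s {S} ∣S∣≤s (λ T → a * monomial T X)) P≤s) ⟩
  ⟦ P ⟧ X ∎
  where
  open ≡-Reasoning
  K : List (Subset n)
  K = smallSubsets n s

combination-vanishes : ∀ {X : Set} {n s} (F : List X) (P : X → Poly n) (w : X → ℤ) →
  (∀ A → DegreeAtMost s (P A)) →
  All (λ T → ∑[ A ∈ F ] (w A * coefficient (P A) T) ≡ 0ℤ) (smallSubsets n s) →
  ∀ Y → ∑[ A ∈ F ] (w A * ⟦ P A ⟧ Y) ≡ 0ℤ
combination-vanishes {n = n} {s} F P w P≤s coefficients-vanish Y = begin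
  ∑[ A ∈ F ] (w A * ⟦ P A ⟧ Y)
    ≡⟨ ∑-cong F (λ A → cong (w A *_) (⟦⟧-coefficients s (P A) (P≤s A) Y)) ⟨
  ∑[ A ∈ F ] (w A * ∑[ T ∈ K ] (coefficient (P A) T * monomial T Y))
    ≡⟨ ∑-cong F (λ A → ∑-*ˡ K (w A) _) ⟨
  ∑[ A ∈ F ] ∑[ T ∈ K ] (w A * (coefficient (P A) T * monomial T Y))
    ≡⟨ ∑-comm F K _ ⟩
  ∑[ T ∈ K ] ∑[ A ∈ F ] (w A * (coefficient (P A) T * monomial T Y))
    ≡⟨ ∑-cong K (λ T → ∑-cong F (λ A → ℤ.*-assoc (w A) _ _)) ⟨
  ∑[ T ∈ K ] ∑[ A ∈ F ] (w A * coefficient (P A) T * monomial T Y)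
    ≡⟨ ∑-cong K (λ T → ∑-*ʳ F (monomial T Y) _) ⟩
  ∑[ T ∈ K ] (∑[ A ∈ F ] (w A * coefficient (P A) T) * monomial T Y)
    ≡⟨ ∑-zero-All (All.map (λ {T} ≡0 → trans (cong (_* monomial T Y) ≡0) (ℤ.*-zeroˡ (monomial T Y))) coefficients-vanish) ⟩
  0ℤ ∎
  where
  open ≡-Reasoning
  K : List (Subset n)
  K = smallSubsets n s

binomSum-suc : ∀ n s → binomSum n (suc s) ≡ binomSum n s ℕ.+ n C suc s
binomSum-suc n s = begin
  sum (map (n C_) (upTo (suc (suc s))))              ≡⟨ cong (sum ∘ map (n C_)) (List.upTo-∷ʳ (suc s)) ⟨
  sum (map (n C_) (upTo (suc s) ++ suc s ∷ []))      ≡⟨ cong sum (List.map-++ (n C_) (upTo (suc s)) _) ⟩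
  sum (map (n C_) (upTo (suc s)) ++ n C suc s ∷ [])  ≡⟨ ℕ.sum-++ (map (n C_) (upTo (suc s))) _ ⟩
  binomSum n s ℕ.+ (n C suc s ℕ.+ 0)                 ≡⟨ cong (binomSum n s ℕ.+_) (ℕ.+-identityʳ _) ⟩
  binomSum n s ℕ.+ n C suc s                         ∎
  where open ≡-Reasoning

binomSum-pascal : ∀ n s → binomSum (suc n) (suc s) ≡ binomSum n (suc s) ℕ.+ binomSum n s
binomSum-pascal n zero = begin
  binomSum (suc n) 1        ≡⟨ binomSum-suc (suc n) 0 ⟩
  1 ℕ.+ suc n C 1           ≡⟨ cong suc (ℕ.nCk+nC[k+1]≡[n+1]C[k+1] n 0) ⟨
  1 ℕ.+ (1 ℕ.+ n C 1)       ≡⟨ cong suc (ℕ.+-comm 1 (n C 1)) ⟩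
  1 ℕ.+ n C 1 ℕ.+ 1         ≡⟨ cong (ℕ._+ 1) (binomSum-suc n 0) ⟨
  binomSum n 1 ℕ.+ 1        ∎
  where open ≡-Reasoning
binomSum-pascal n (suc s) = begin
  binomSum (suc n) (2+ s)                                             ≡⟨ binomSum-suc (suc n) (suc s) ⟩
  binomSum (suc n) (suc s) ℕ.+ suc n C 2+ s                           ≡⟨ cong₂ ℕ._+_ (binomSum-pascal n s) pascal ⟩
  (binomSum n (suc s) ℕ.+ binomSum n s) ℕ.+ (n C 2+ s ℕ.+ n C suc s)  ≡⟨ ℕ-+.interchange (binomSum n (suc s)) _ _ _ ⟩
  (binomSum n (suc s) ℕ.+ n C 2+ s) ℕ.+ (binomSum n s ℕ.+ n C suc s)  ≡⟨ cong₂ ℕ._+_ (binomSum-suc n (suc s)) (binomSum-suc n s) ⟨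
  binomSum n (2+ s) ℕ.+ binomSum n (suc s)                            ∎
  where
  open ≡-Reasoning
  pascal : suc n C 2+ s ≡ n C 2+ s ℕ.+ n C suc s
  pascal = trans (sym (ℕ.nCk+nC[k+1]≡[n+1]C[k+1] n (suc s))) (ℕ.+-comm (n C suc s) _)

binomSum-zero : ∀ s → binomSum 0 s ≡ 1
binomSum-zero zero    = refl
binomSum-zero (suc s) = trans (binomSum-suc 0 s) (cong (ℕ._+ 0) (binomSum-zero s))

length-smallSubsets : ∀ n s → length (smallSubsets n s) ≡ binomSum n s
length-smallSubsets zero    s       = sym (binomSum-zero s)
length-smallSubsets (suc n) zero    = trans (List.length-map _ (smallSubsets n zero)) (length-smallSubsets n zero)
length-smallSubsets (suc n) (suc s) = begin
  length (map (outside ∷_) (smallSubsets n (suc s)) ++ map (inside ∷_) (smallSubsets n s))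
    ≡⟨ List.length-++ (map (outside ∷_) (smallSubsets n (suc s))) ⟩
  length (map (outside ∷_) (smallSubsets n (suc s))) ℕ.+ length (map (inside ∷_) (smallSubsets n s))
    ≡⟨ cong₂ ℕ._+_ (List.length-map _ (smallSubsets n (suc s))) (List.length-map _ (smallSubsets n s)) ⟩
  length (smallSubsets n (suc s)) ℕ.+ length (smallSubsets n s)
    ≡⟨ cong₂ ℕ._+_ (length-smallSubsets n (suc s)) (length-smallSubsets n s) ⟩
  binomSum n (suc s) ℕ.+ binomSum n s
    ≡⟨ binomSum-pascal n s ⟨
  binomSum (suc n) (suc s) ∎
  where open ≡-Reasoning

module _ {p : ℕ} .{{_ : NonZero p}} (p-prime : Prime p) where

  private
    1<p : 1 < p
    1<p = ℕ.nonTrivial⇒n>1 p {{prime⇒nonTrivial p-prime}}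

  vp-fuel-factorisation : ∀ f m → 0 < m → m ≤ f → Σ ℕ λ u → m ≡ p ^ vp-fuel f p m ℕ.* u × ¬ p ∣ u
  vp-fuel-factorisation zero    (suc m) _   ()
  vp-fuel-factorisation (suc f) m       0<m m≤1+f with p ∣? m
  ... | no  p∤m = m , sym (ℕ.*-identityˡ m) , p∤m
  ... | yes p∣m with vp-fuel-factorisation f (m / p) 0<m/p (ℕ.≤-pred (ℕ.<-≤-trans (m/n<m m p 1<p) m≤1+f))
    where
    instance
      m≢0 : NonZero m
      m≢0 = ℕ.>-nonZero 0<m
    0<m/p : 0 < m / p
    0<m/p = m≥n⇒m/n>0 (∣⇒≤ p∣m)
  ...   | u , m/p≡ , p∤u = u , trans (sym (m*[n/m]≡n p∣m)) (trans (cong (p ℕ.*_) m/p≡) (sym (ℕ.*-assoc p _ u))) , p∤u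

  v-factorisation : ∀ m → 0 < m → Σ ℕ λ u → m ≡ p ^ v p m ℕ.* u × ¬ p ∣ u
  v-factorisation m 0<m = vp-fuel-factorisation m m 0<m ℕ.≤-refl

  product-factorisation : ∀ L → All (0 <_) L → Σ ℕ λ u → product L ≡ p ^ sumV p L ℕ.* u × ¬ p ∣ u
  product-factorisation []      []            = 1 , refl , λ p∣1 → ℕ.<-irrefl (sym (∣1⇒≡1 p∣1)) 1<p
  product-factorisation (ℓ ∷ L) (0<ℓ ∷ 0<L) with v-factorisation ℓ 0<ℓ | product-factorisation L 0<L
  ... | u , ℓ≡ , p∤u | w , L≡ , p∤w = u ℕ.* w , eq , p∤u*w
    where
    eq : ℓ ℕ.* product L ≡ p ^ (v p ℓ ℕ.+ sumV p L) ℕ.* (u ℕ.* w)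
    eq = begin
      ℓ ℕ.* product L                               ≡⟨ cong₂ ℕ._*_ ℓ≡ L≡ ⟩
      (p ^ v p ℓ ℕ.* u) ℕ.* (p ^ sumV p L ℕ.* w)   ≡⟨ ℕ-*.interchange (p ^ v p ℓ) u _ w ⟩
      (p ^ v p ℓ ℕ.* p ^ sumV p L) ℕ.* (u ℕ.* w)   ≡⟨ cong (ℕ._* (u ℕ.* w)) (ℕ.^-distribˡ-+-* p (v p ℓ) _) ⟨
      p ^ (v p ℓ ℕ.+ sumV p L) ℕ.* (u ℕ.* w)       ∎
      where open ≡-Reasoning
    p∤u*w : ¬ p ∣ u ℕ.* w
    p∤u*w p∣u*w = [ p∤u , p∤w ]′ (euclidsLemma u w p-prime p∣u*w)

  p^j∣x*u⇒p^j∣x : ∀ j {x u} → ¬ p ∣ u → p ^ j ∣ x ℕ.* u → p ^ j ∣ x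
  p^j∣x*u⇒p^j∣x zero    {x}     p∤u _ = 1∣ x
  p^j∣x*u⇒p^j∣x (suc j) {x} {u} p∤u p^[1+j]∣x*u
    with euclidsLemma x u p-prime (∣-trans (m∣m*n (p ^ j)) p^[1+j]∣x*u)
  ... | inj₂ p∣u            = ⊥-elim (p∤u p∣u)
  ... | inj₁ (divides y refl) = subst (_∣ y ℕ.* p) (ℕ.*-comm (p ^ j) p) (*-monoˡ-∣ p (p^j∣x*u⇒p^j∣x j {y} p∤u p^j∣y*u))
    where
    p^j∣y*u : p ^ j ∣ y ℕ.* u
    p^j∣y*u = *-cancelˡ-∣ {p ^ j} p (subst (p ℕ.* p ^ j ∣_) (ℕ-*.xy∙z≈y∙xz y p u) p^[1+j]∣x*u)

  p^j*p^k∣x*[p^s*u]⇒p^[1+j]∣x : ∀ j {k s x u} → s < k → ¬ p ∣ u → p ^ j ℕ.* p ^ k ∣ x ℕ.* (p ^ s ℕ.* u) → p ^ suc j ∣ x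
  p^j*p^k∣x*[p^s*u]⇒p^[1+j]∣x j {s = s} {x} {u} s<k p∤u p^j*p^k∣ with ℕ.m≤n⇒∃[o]m+o≡n s<k
  ... | t , refl = p^j∣x*u⇒p^j∣x (suc j) p∤u (m*n∣⇒m∣ (p ^ suc j) (p ^ t) (*-cancelˡ-∣ (p ^ s) (subst₂ _∣_ lhs rhs p^j*p^k∣)))
    where
    instance
      p^s≢0 : NonZero (p ^ s)
      p^s≢0 = ℕ.m^n≢0 p s
    lhs : p ^ j ℕ.* p ^ (suc s ℕ.+ t) ≡ p ^ s ℕ.* (p ^ suc j ℕ.* p ^ t)
    lhs = begin
      p ^ j ℕ.* p ^ (suc s ℕ.+ t)           ≡⟨ cong (p ^ j ℕ.*_) (ℕ.^-distribˡ-+-* p (suc s) t) ⟩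
      p ^ j ℕ.* (p ℕ.* p ^ s ℕ.* p ^ t)     ≡⟨ ℕ-solve p (p ^ j) (p ^ s) (p ^ t) ⟩
      p ^ s ℕ.* (p ℕ.* p ^ j ℕ.* p ^ t)     ∎
      where
      open ≡-Reasoning
      ℕ-solve : ∀ a b c d → b ℕ.* (a ℕ.* c ℕ.* d) ≡ c ℕ.* (a ℕ.* b ℕ.* d)
      ℕ-solve = ℕ.solve-∀
    rhs : x ℕ.* (p ^ s ℕ.* u) ≡ p ^ s ℕ.* (x ℕ.* u)
    rhs = ℕ-*.x∙yz≈y∙xz x (p ^ s) u

  n<p^n : ∀ n → n < p ^ n
  n<p^n zero    = s≤s z≤n
  n<p^n (suc n) = ℕ.≤-<-trans (n<p^n n) (ℕ.^-monoʳ-< p 1<p (ℕ.n<1+n n))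

  p^n∣n⇒n≡0 : ∀ {n} → p ^ n ∣ n → n ≡ 0
  p^n∣n⇒n≡0 {zero}  _   = refl
  p^n∣n⇒n≡0 {suc n} p^n∣n = ⊥-elim (ℕ.<⇒≱ (n<p^n (suc n)) (∣⇒≤ p^n∣n))

*-pres-∣ : ∀ {a b x y} → a ℤ∣.∣ x → b ℤ∣.∣ y → a * b ℤ∣.∣ x * y
*-pres-∣ {b = b} {x} a∣x b∣y = ℤ∣.∣-trans (ℤ∣.*-monoˡ-∣ b a∣x) (ℤ∣.*-monoʳ-∣ x b∣y)

≡[mod]⇒∣- : ∀ a b q .{{_ : NonZero q}} → a ≡ b [mod q ] → + q ℤ∣.∣ + a - + b
≡[mod]⇒∣- a b q a≡b = divides (+ (a / q) - + (b / q)) (begin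
  + a - + b
    ≡⟨ cong₂ _-_ (split a) (trans (split b) (cong (λ r → + r + + (b / q) * + q) (sym a≡b))) ⟩
  + (a % q) + + (a / q) * + q - (+ (a % q) + + (b / q) * + q)
    ≡⟨ cancel (+ (a % q)) (+ (a / q)) (+ (b / q)) (+ q) ⟩
  (+ (a / q) - + (b / q)) * + q ∎)
  where
  open ≡-Reasoning
  split : ∀ m → + m ≡ + (m % q) + + (m / q) * + q
  split m = trans (cong +_ (m≡m%n+[m/n]*n m q)) (trans (ℤ.pos-+ (m % q) _) (cong (_+_ (+ (m % q))) (ℤ.pos-* (m / q) q)))
  cancel : ∀ r x y z → r + x * z - (r + y * z) ≡ (x - y) * z
  cancel = solve-∀

∣p─p∣≡0 : ∀ {n} (p : Subset n) → ∣ p ─ p ∣ ≡ 0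
∣p─p∣≡0 []            = refl
∣p─p∣≡0 (inside  ∷ p) = ∣p─p∣≡0 p
∣p─p∣≡0 (outside ∷ p) = ∣p─p∣≡0 p

∣fValue-diagonal∣ : ∀ {n} (B : Subset n) L → ℤ.∣ fValue B B L ∣ ≡ product L
∣fValue-diagonal∣ B []      = refl
∣fValue-diagonal∣ B (ℓ ∷ L) = begin
  ℤ.∣ (+ ∣ B ─ B ∣ - + ℓ) * fValue B B L ∣          ≡⟨ ℤ.abs-* (+ ∣ B ─ B ∣ - + ℓ) _ ⟩
  ℤ.∣ + ∣ B ─ B ∣ - + ℓ ∣ ℕ.* ℤ.∣ fValue B B L ∣     ≡⟨ cong₂ ℕ._*_ ∣0-ℓ∣ (∣fValue-diagonal∣ B L) ⟩
  ℓ ℕ.* product L                                  ∎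
  where
  open ≡-Reasoning
  ∣0-ℓ∣ : ℤ.∣ + ∣ B ─ B ∣ - + ℓ ∣ ≡ ℓ
  ∣0-ℓ∣ rewrite ∣p─p∣≡0 B = trans (cong ℤ.∣_∣ (ℤ.+-identityˡ (- + ℓ))) (ℤ.∣-i∣≡∣i∣ (+ ℓ))

∣-fValue : ∀ {n} {d} (A X : Subset n) {ℓ L} → ℓ ∈ L → d ℤ∣.∣ + ∣ A ─ X ∣ - + ℓ → d ℤ∣.∣ fValue A X L
∣-fValue A X {L = ℓ′ ∷ L} (here refl) d∣ = ℤ∣.∣m⇒∣m*n (fValue A X L) d∣
∣-fValue A X {L = ℓ′ ∷ L} (there ℓ∈L) d∣ = ℤ∣.∣n⇒∣m*n (+ ∣ A ─ X ∣ - + ℓ′) (∣-fValue A X ℓ∈L d∣)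

module _ {p k n : ℕ} .{{_ : NonZero p}} .{{_ : NonZero (p ^ k)}} (p-prime : Prime p)
         {L : List ℕ} (L-positive : All (0 <_) L) (sumV<k : sumV p L < k)
         {F : List (Subset n)} (F-unique : Unique F) (sperner : DifferencingSperner (p ^ k) L F)
         (w : Subset n → ℤ) (relation : ∀ X → ∑[ A ∈ F ] (w A * fValue A X L) ≡ 0ℤ) where

  p^[1+j]∣weights : ∀ {j} → All (λ A → p ^ j ∣ ℤ.∣ w A ∣) F → All (λ A → p ^ suc j ∣ ℤ.∣ w A ∣) F
  p^[1+j]∣weights {j} p^j∣w = All.tabulate p^[1+j]∣w
    where
    d : ℤ
    d = + (p ^ j) * + (p ^ k)

    d∣others : ∀ {B} (B∈F : B ∈ F) → All (λ A → d ℤ∣.∣ w A * fValue A B L) (F Any.─ B∈F)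
    d∣others {B} B∈F = All.tabulate λ {A} A∈F─B →
      let A∈F             = ∈-─⁻ B∈F A∈F─B
          ℓ , ℓ∈L , A─B≡ℓ = sperner A∈F B∈F (All.lookup (Unique⇒All≢─ B∈F F-unique) A∈F─B)
      in *-pres-∣ (ℤ∣.∣ᵤ⇒∣ {+ (p ^ j)} {w A} (All.lookup p^j∣w A∈F))
                  (∣-fValue A B ℓ∈L (≡[mod]⇒∣- _ ℓ (p ^ k) A─B≡ℓ))

    d∣diagonal : ∀ {B} → B ∈ F → d ℤ∣.∣ w B * fValue B B L
    d∣diagonal B∈F = ℤ∣.∣m+n∣n⇒∣m (subst (d ℤ∣.∣_) (trans (sym (relation _)) (∑-─ B∈F _)) (divides 0ℤ refl))
                                  (∑-∣ (F Any.─ B∈F) (d∣others B∈F))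

    p^[1+j]∣w : ∀ {B} → B ∈ F → p ^ suc j ∣ ℤ.∣ w B ∣
    p^[1+j]∣w {B} B∈F =
      let u , product≡ , p∤u = product-factorisation p-prime L L-positive
      in p^j*p^k∣x*[p^s*u]⇒p^[1+j]∣x p-prime j sumV<k p∤u
           (subst₂ _∣_ (ℤ.abs-* (+ (p ^ j)) (+ (p ^ k)))
                       (trans (ℤ.abs-* (w B) _) (cong (ℤ.∣ w B ∣ ℕ.*_) (trans (∣fValue-diagonal∣ B L) product≡)))
                       (ℤ∣.∣⇒∣ᵤ (d∣diagonal B∈F)))

  p^j∣weights : ∀ j → All (λ A → p ^ j ∣ ℤ.∣ w A ∣) F
  p^j∣weights zero    = All.tabulate (λ {A} _ → 1∣ ℤ.∣ w A ∣)
  p^j∣weights (suc j) = p^[1+j]∣weights {j} (p^j∣weights j)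

  weights-vanish : All (λ A → w A ≡ 0ℤ) F
  weights-vanish = All.tabulate λ {A} A∈F →
    ℤ.∣i∣≡0⇒i≡0 (p^n∣n⇒n≡0 p-prime (All.lookup (p^j∣weights ℤ.∣ w A ∣) A∈F))

corollary4p1 : (p k n : ℕ) → (pp : Prime p) → .{{_ : NonZero p}} → .{{_ : NonZero (p ^ k)}}
    → (L : List ℕ) → Unique L → (∀ {ℓ} → ℓ ∈ L → 1 ≤ ℓ × ℓ ≤ p ^ k ∸ 1)
    → (F : List (Subset n)) → Unique F
    → DifferencingSperner (p ^ k) L F
    → sumV p L < k
    → length F ≤ binomSum n (length L)
corollary4p1 p k n pp L _ L-range F F-unique sperner sumV<k with length F ℕ.≤? binomSum n (length L)
... | yes F≤ = F≤
... | no  F≰ = ⊥-elim (All.Any¬⇒¬All nontrivial (weights-vanish pp L-positive sumV<k F-unique sperner coeff relation))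
  where
  s : ℕ
  s = length L
  L-positive : All (0 <_) L
  L-positive = All.tabulate (proj₁ ∘ L-range)
  more-sets-than-monomials : length (smallSubsets n s) < length F
  more-sets-than-monomials = subst (_< length F) (sym (length-smallSubsets n s)) (ℕ.≰⇒> F≰)
  open LinearDependency (linearDependency (Vec.≡-dec Bool._≟_) F (smallSubsets n s) F-unique more-sets-than-monomials
                                          (λ A → coefficient (fPoly A L)))
  relation : ∀ X → ∑[ A ∈ F ] (coeff A * fValue A X L) ≡ 0ℤ
  relation X = trans (∑-cong F (λ A → cong (coeff A *_) (sym (⟦fPoly⟧ A X L))))
                     (combination-vanishes F (λ A → fPoly A L) coeff (λ A → degree-fPoly A L) vanishes X)
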